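{- Let $k\ge1$ and $1\le l,m\le k$ be integers, and let $c^{(k)}_{l,m}$ be the coefficient of $x^{\underline{l}}y^{\underline{m}}$ in the unique expansion $(xy)^{\underline{k}} = \sum_{l,m=1}^k c^{(k)}_{l,m}\, x^{\underline{l}}\, y^{\underline{m}}$. Then $c^{(k)}_{l,m}=0$ if $lm<k$, and $c^{(k)}_{l,m}>0$ if $lm\ge k$.
   Context: $x^{\underline{n}}=x(x-1)\cdots(x-n+1)$ is the falling factorial power. -}

module Defs where

open import Data.Nat using (ℕ; zero; suc)
open import Data.Integer using (ℤ; +_; _+_; _-_; _*_)

fallingFactorial : ℤ → ℕ → ℤ
fallingFactorial x zero    = + 1
fallingFactorial x (suc n) = fallingFactorial x n * (x - + n)

sum1to : ℕ → (ℕ → ℤ) → ℤ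
sum1to zero    f = + 0
sum1to (suc k) f = sum1to k f + f (suc k)

-- c is a coefficient family for the expansion
--   (xy)^{\underline k} = Σ_{l,m=1}^k c l m x^{\underline l} y^{\underline m}
-- as a polynomial identity in ℤ[x,y] (equivalently: for all integers x, y).
IsExpansion : ℕ → (ℕ → ℕ → ℤ) → Set
IsExpansion k c = ∀ (x y : ℤ) →
  fallingFactorial (x * y) k ≡
    sum1to k (λ l → sum1to k (λ m → c l m * (fallingFactorial x l * fallingFactorial y m)))
  where open import Relation.Binary.PropositionalEquality using (_≡_)

-- Multiplying x↓l · y↓m by xy − k = (x − l)(y − m) + m (x − l) + l (y − m) + (lm − k) rewrites it through
-- x↓(l+1) y↓(m+1), x↓(l+1) y↓m, x↓l y↓(m+1) and x↓l y↓m, so the coefficients of (xy)↓k obey a recurrence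
-- with the nonnegative weights 1, m, l and lm − k. Induction on k gives c_{l,m} = 0 when lm < k, and
-- c_{l,m} > 0 when lm ≥ k because one of the four predecessor terms is already positive. Every expansion
-- has these coefficients: evaluating a combination of x↓1, …, x↓k at x = 1, 2, …, k recovers its
-- coefficients one at a time, since j↓l vanishes for l > j and j↓j = j! ≠ 0.
module Submission where

open import Defs
open import Data.Nat using (ℕ; _≤_; _<_; _≥_)
import Data.Nat as N
open import Data.Integer using (ℤ; +_)
import Data.Integer as Z
open import Data.Product using (_×_; Σ; _,_)
open import Relation.Binary.PropositionalEquality using (_≡_)

module Coefficients where
  open import Data.Nat
  open import Data.Nat.Properties
  open import Data.Sum using (_⊎_; inj₁; inj₂)
  open import Relation.Binary.PropositionalEquality using (_≡_; refl; cong)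

  shiftˡ shiftʳ : (ℕ → ℕ → ℕ) → ℕ → ℕ → ℕ
  shiftˡ F zero    m = 0
  shiftˡ F (suc l) m = F l m
  shiftʳ F l zero    = 0
  shiftʳ F l (suc m) = F l m

  scaleˡ scaleʳ : (ℕ → ℕ → ℕ) → ℕ → ℕ → ℕ
  scaleˡ F l m = l * F l m
  scaleʳ F l m = m * F l m

  excess : ℕ → (ℕ → ℕ → ℕ) → ℕ → ℕ → ℕ
  excess k F l m = (l * m ∸ k) * F l m

  infixl 6 _⊕_
  _⊕_ : (ℕ → ℕ → ℕ) → (ℕ → ℕ → ℕ) → ℕ → ℕ → ℕ
  (F ⊕ G) l m = F l m + G l m

  -- c⁽ᵏ⁺¹⁾ₗₘ = c⁽ᵏ⁾₍ₗ₋₁₎₍ₘ₋₁₎ + m c⁽ᵏ⁾₍ₗ₋₁₎ₘ + l c⁽ᵏ⁾ₗ₍ₘ₋₁₎ + (lm − k) c⁽ᵏ⁾ₗₘ. The truncation in lm ∸ k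
  -- is harmless because c⁽ᵏ⁾ₗₘ = 0 whenever lm < k (coeff-zero).
  coeff : ℕ → ℕ → ℕ → ℕ
  coeff zero    zero zero = 1
  coeff zero    _    _    = 0
  coeff (suc k) l m = (shiftˡ (shiftʳ (coeff k)) ⊕ shiftˡ (scaleʳ (coeff k))
                       ⊕ shiftʳ (scaleˡ (coeff k)) ⊕ excess k (coeff k)) l m

  n≡0⇒m*n≡0 : ∀ m {n} → n ≡ 0 → m * n ≡ 0
  n≡0⇒m*n≡0 m refl = *-zeroʳ m

  private
    +₄≡0 : ∀ {a b c d} → a ≡ 0 → b ≡ 0 → c ≡ 0 → d ≡ 0 → a + b + c + d ≡ 0
    +₄≡0 refl refl refl refl = refl

    0<m⇒0<m+n : ∀ {m} n → 0 < m → 0 < m + n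
    0<m⇒0<m+n n 0<m = <-≤-trans 0<m (m≤m+n _ n)

    0<n⇒0<m+n : ∀ m {n} → 0 < n → 0 < m + n
    0<n⇒0<m+n m 0<n = <-≤-trans 0<n (m≤n+m _ m)

    0<m*n : ∀ {m n} → 0 < m → 0 < n → 0 < m * n
    0<m*n z<s z<s = z<s

  coeff-zero : ∀ k l m → l * m < k → coeff k l m ≡ 0
  coeff-zero (suc k) l m lm<1+k =
    +₄≡0 (diagonal l m lm<1+k) (left l m lm<1+k) (right l m lm<1+k)
         (cong (_* coeff k l m) (m≤n⇒m∸n≡0 (s≤s⁻¹ lm<1+k)))
    where
    diagonal : ∀ l m → l * m < suc k → shiftˡ (shiftʳ (coeff k)) l m ≡ 0
    diagonal zero    m       _ = refl
    diagonal (suc l) zero    _ = refl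
    diagonal (suc l) (suc m) h = coeff-zero k l m (<-≤-trans (*-mono-< (n<1+n l) (n<1+n m)) (s≤s⁻¹ h))
    left : ∀ l m → l * m < suc k → shiftˡ (scaleʳ (coeff k)) l m ≡ 0
    left zero    m       _ = refl
    left (suc l) zero    _ = refl
    left (suc l) (suc m) h =
      n≡0⇒m*n≡0 (suc m) (coeff-zero k l (suc m) (<-≤-trans (*-monoˡ-< (suc m) (n<1+n l)) (s≤s⁻¹ h)))
    right : ∀ l m → l * m < suc k → shiftʳ (scaleˡ (coeff k)) l m ≡ 0
    right l       zero    _ = refl
    right zero    (suc m) _ = refl
    right (suc l) (suc m) h =
      n≡0⇒m*n≡0 (suc l) (coeff-zero k (suc l) m (<-≤-trans (*-monoʳ-< (suc l) (n<1+n m)) (s≤s⁻¹ h)))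

  coeff-vanishˡ : ∀ k l m → k < l → coeff k l m ≡ 0
  coeff-vanishˡ zero    (suc l) m _         = refl
  coeff-vanishˡ (suc k) (suc l) m (s≤s k<l) =
    +₄≡0 (diagonal m) (n≡0⇒m*n≡0 m (coeff-vanishˡ k l m k<l)) (right m)
         (n≡0⇒m*n≡0 (suc l * m ∸ k) (coeff-vanishˡ k (suc l) m (m<n⇒m<1+n k<l)))
    where
    diagonal : ∀ m → shiftʳ (coeff k) l m ≡ 0
    diagonal zero    = refl
    diagonal (suc m) = coeff-vanishˡ k l m k<l
    right : ∀ m → shiftʳ (scaleˡ (coeff k)) (suc l) m ≡ 0
    right zero    = refl
    right (suc m) = n≡0⇒m*n≡0 (suc l) (coeff-vanishˡ k (suc l) m (m<n⇒m<1+n k<l))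

  coeff-vanishʳ : ∀ k l m → k < m → coeff k l m ≡ 0
  coeff-vanishʳ zero    zero    (suc m) _         = refl
  coeff-vanishʳ zero    (suc l) (suc m) _         = refl
  coeff-vanishʳ (suc k) l       (suc m) (s≤s k<m) =
    +₄≡0 (diagonal l) (left l) (n≡0⇒m*n≡0 l (coeff-vanishʳ k l m k<m))
         (n≡0⇒m*n≡0 (l * suc m ∸ k) (coeff-vanishʳ k l (suc m) (m<n⇒m<1+n k<m)))
    where
    diagonal : ∀ l → shiftˡ (shiftʳ (coeff k)) l (suc m) ≡ 0
    diagonal zero    = refl
    diagonal (suc l) = coeff-vanishʳ k l m k<m
    left : ∀ l → shiftˡ (scaleʳ (coeff k)) l (suc m) ≡ 0
    left zero    = refl
    left (suc l) = n≡0⇒m*n≡0 (suc m) (coeff-vanishʳ k l (suc m) (m<n⇒m<1+n k<m))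

  coeff-suc-positive : ∀ k l m →
    0 < shiftˡ (shiftʳ (coeff k)) l m ⊎ 0 < shiftˡ (scaleʳ (coeff k)) l m ⊎
    0 < shiftʳ (scaleˡ (coeff k)) l m ⊎ 0 < excess k (coeff k) l m →
    0 < coeff (suc k) l m
  coeff-suc-positive k l m = λ where
      (inj₁ 0<a)               → 0<m⇒0<m+n d (0<m⇒0<m+n c (0<m⇒0<m+n b 0<a))
      (inj₂ (inj₁ 0<b))        → 0<m⇒0<m+n d (0<m⇒0<m+n c (0<n⇒0<m+n a 0<b))
      (inj₂ (inj₂ (inj₁ 0<c))) → 0<m⇒0<m+n d (0<n⇒0<m+n (a + b) 0<c)
      (inj₂ (inj₂ (inj₂ 0<d))) → 0<n⇒0<m+n (a + b + c) 0<d
    where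
    a b c d : ℕ
    a = shiftˡ (shiftʳ (coeff k)) l m
    b = shiftˡ (scaleʳ (coeff k)) l m
    c = shiftʳ (scaleˡ (coeff k)) l m
    d = excess k (coeff k) l m

  coeff-positive : ∀ k {l m} → 1 ≤ l → l ≤ k → 1 ≤ m → m ≤ k → k ≤ l * m → 0 < coeff k l m
  coeff-positive zero    (s≤s _) () _ _ _
  coeff-positive (suc k) {l} {m} 1≤l l≤1+k 1≤m m≤1+k 1+k≤lm
    with m≤n⇒m<n∨m≡n l≤1+k | m≤n⇒m<n∨m≡n m≤1+k
  ... | inj₁ (s≤s l≤k) | inj₁ (s≤s m≤k) = coeff-suc-positive k l m (inj₂ (inj₂ (inj₂
    (0<m*n (m<n⇒0<n∸m 1+k≤lm) (coeff-positive k 1≤l l≤k 1≤m m≤k (≤-trans (n≤1+n k) 1+k≤lm))))))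
  ... | inj₂ refl      | inj₁ (s≤s m≤k) = coeff-suc-positive k l m (inj₂ (inj₁
    (0<m*n 1≤m (coeff-positive k (≤-trans 1≤m m≤k) ≤-refl 1≤m m≤k (m≤m*n k m {{>-nonZero 1≤m}})))))
  ... | inj₁ (s≤s l≤k) | inj₂ refl      = coeff-suc-positive k l m (inj₂ (inj₂ (inj₁
    (0<m*n 1≤l (coeff-positive k 1≤l l≤k (≤-trans 1≤l l≤k) ≤-refl (m≤n*m k l {{>-nonZero 1≤l}}))))))
  ... | inj₂ refl      | inj₂ refl      = coeff-suc-positive k l m (inj₁ (diagonal k))
    where
    diagonal : ∀ k → 0 < coeff k k k
    diagonal zero    = z<s
    diagonal (suc k) = coeff-positive (suc k) z<s ≤-refl z<s ≤-refl (m≤m*n (suc k) (suc k))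

open Coefficients
open import Data.Nat using (zero; suc; z≤n; s≤s)
import Data.Nat.Properties as ℕₚ
open import Data.Nat.Properties
  using (≤-refl; ≤-trans; <-irrefl; n≤1+n; n<1+n; m≤n⇒m≤1+n; m≤n⇒m<n∨m≡n; ≮⇒≥)
open import Data.Integer using (_+_; _-_; _*_; 0ℤ; +<+; ≢-nonZero)
open import Data.Integer.Properties
  using (+-identityˡ; +-identityʳ; +-assoc; +-inverseʳ; *-zeroʳ; *-assoc; *-comm; *-distribʳ-+;
         pos-+; pos-*; +-injective; i-j≡0⇒i≡j; m-n≡m⊖n; ⊖-≥; *-cancelʳ-≡; i*j≡0⇒i≡0∨j≡0;
         +-0-abelianGroup; +-commutativeSemigroup)
open import Algebra.Properties.AbelianGroup +-0-abelianGroup using (∙-cancelˡ)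
open import Algebra.Properties.CommutativeSemigroup +-commutativeSemigroup using (interchange)
open import Data.Integer.Tactic.RingSolver using (solve-∀)
open import Data.Sum using (inj₁; inj₂)
open import Function using (_∘_)
open import Relation.Nullary using (yes; no)
open import Relation.Binary.PropositionalEquality
  using (refl; sym; trans; cong; cong₂; subst; _≢_; module ≡-Reasoning)
open ≡-Reasoning

sum1to-cong : ∀ n {f g : ℕ → ℤ} → (∀ i → 1 ≤ i → i ≤ n → f i ≡ g i) → sum1to n f ≡ sum1to n g
sum1to-cong zero    f≡g = refl
sum1to-cong (suc n) f≡g =
  cong₂ _+_ (sum1to-cong n (λ i 1≤i i≤n → f≡g i 1≤i (m≤n⇒m≤1+n i≤n))) (f≡g (suc n) (s≤s z≤n) ≤-refl)

sum1to-zero : ∀ n {f : ℕ → ℤ} → (∀ i → f i ≡ 0ℤ) → sum1to n f ≡ 0ℤ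
sum1to-zero zero    f≡0 = refl
sum1to-zero (suc n) f≡0 = cong₂ _+_ (sum1to-zero n f≡0) (f≡0 (suc n))

sum1to-+ : ∀ n (f g : ℕ → ℤ) → sum1to n (λ i → f i + g i) ≡ sum1to n f + sum1to n g
sum1to-+ zero    f g = refl
sum1to-+ (suc n) f g =
  trans (cong (_+ (f (suc n) + g (suc n))) (sum1to-+ n f g))
        (interchange (sum1to n f) (sum1to n g) (f (suc n)) (g (suc n)))

sum1to-*ʳ : ∀ n (f : ℕ → ℤ) z → sum1to n f * z ≡ sum1to n (λ i → f i * z)
sum1to-*ʳ zero    f z = refl
sum1to-*ʳ (suc n) f z =
  trans (*-distribʳ-+ z (sum1to n f) (f (suc n))) (cong (_+ f (suc n) * z) (sum1to-*ʳ n f z))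

sum1to-truncate : ∀ {j} k (f : ℕ → ℤ) → j ≤ k → (∀ i → j < i → i ≤ k → f i ≡ 0ℤ) →
                  sum1to k f ≡ sum1to j f
sum1to-truncate zero    f z≤n     _    = refl
sum1to-truncate {j} (suc k) f j≤1+k f≡0 with m≤n⇒m<n∨m≡n j≤1+k
... | inj₂ refl        = refl
... | inj₁ (s≤s j≤k) = begin
  sum1to k f + f (suc k) ≡⟨ cong₂ _+_ (sum1to-truncate k f j≤k (λ i j<i i≤k → f≡0 i j<i (m≤n⇒m≤1+n i≤k)))
                                       (f≡0 (suc k) (s≤s j≤k) ≤-refl) ⟩
  sum1to j f + 0ℤ        ≡⟨ +-identityʳ (sum1to j f) ⟩
  sum1to j f             ∎

sum0to : ℕ → (ℕ → ℤ) → ℤ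
sum0to n f = f 0 + sum1to n f

sum1to-suc : ∀ n (f : ℕ → ℤ) → sum1to (suc n) f ≡ sum0to n (f ∘ suc)
sum1to-suc zero    f = trans (+-identityˡ (f 1)) (sym (+-identityʳ (f 1)))
sum1to-suc (suc n) f = trans (cong (_+ f (suc (suc n))) (sum1to-suc n f)) (+-assoc (f 1) _ _)

sum0to-cong : ∀ n {f g : ℕ → ℤ} → (∀ i → f i ≡ g i) → sum0to n f ≡ sum0to n g
sum0to-cong n f≡g = cong₂ _+_ (f≡g 0) (sum1to-cong n (λ i _ _ → f≡g i))

sum0to-zero : ∀ n {f : ℕ → ℤ} → (∀ i → f i ≡ 0ℤ) → sum0to n f ≡ 0ℤ
sum0to-zero n f≡0 = cong₂ _+_ (f≡0 0) (sum1to-zero n f≡0)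

sum0to-+ : ∀ n (f g : ℕ → ℤ) → sum0to n (λ i → f i + g i) ≡ sum0to n f + sum0to n g
sum0to-+ n f g =
  trans (cong (_+_ (f 0 + g 0)) (sum1to-+ n f g)) (interchange (f 0) (g 0) (sum1to n f) (sum1to n g))

sum0to-*ʳ : ∀ n (f : ℕ → ℤ) z → sum0to n f * z ≡ sum0to n (λ i → f i * z)
sum0to-*ʳ n f z = trans (*-distribʳ-+ z (f 0) (sum1to n f)) (cong (_+_ (f 0 * z)) (sum1to-*ʳ n f z))

sum0to-shift : ∀ n (f : ℕ → ℤ) → f 0 ≡ 0ℤ → sum0to (suc n) f ≡ sum0to n (f ∘ suc)
sum0to-shift n f f0≡0 = trans (cong (_+ sum1to (suc n) f) f0≡0) (trans (+-identityˡ _) (sum1to-suc n f))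

sum0to-drop-last : ∀ n (f : ℕ → ℤ) → f (suc n) ≡ 0ℤ → sum0to (suc n) f ≡ sum0to n f
sum0to-drop-last n f f[1+n]≡0 =
  cong (_+_ (f 0)) (trans (cong (_+_ (sum1to n f)) f[1+n]≡0) (+-identityʳ (sum1to n f)))

Σ² : ℕ → (ℕ → ℕ → ℤ) → ℤ
Σ² n G = sum0to n (λ l → sum0to n (G l))

Σ²-cong : ∀ n {G H : ℕ → ℕ → ℤ} → (∀ l m → G l m ≡ H l m) → Σ² n G ≡ Σ² n H
Σ²-cong n G≡H = sum0to-cong n (λ l → sum0to-cong n (G≡H l))

Σ²-+ : ∀ n (G H : ℕ → ℕ → ℤ) → Σ² n (λ l m → G l m + H l m) ≡ Σ² n G + Σ² n H
Σ²-+ n G H = trans (sum0to-cong n (λ l → sum0to-+ n (G l) (H l)))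
                   (sum0to-+ n (λ l → sum0to n (G l)) (λ l → sum0to n (H l)))

Σ²-+₄ : ∀ n (A B C D : ℕ → ℕ → ℤ) →
        Σ² n (λ l m → A l m + B l m + C l m + D l m) ≡ Σ² n A + Σ² n B + Σ² n C + Σ² n D
Σ²-+₄ n A B C D = begin
  Σ² n (λ l m → A l m + B l m + C l m + D l m)  ≡⟨ Σ²-+ n (λ l m → A l m + B l m + C l m) D ⟩
  Σ² n (λ l m → A l m + B l m + C l m) + Σ² n D ≡⟨ cong (_+ Σ² n D) (Σ²-+ n (λ l m → A l m + B l m) C) ⟩
  Σ² n (λ l m → A l m + B l m) + Σ² n C + Σ² n D ≡⟨ cong (λ s → s + Σ² n C + Σ² n D) (Σ²-+ n A B) ⟩
  Σ² n A + Σ² n B + Σ² n C + Σ² n D             ∎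

Σ²-*ʳ : ∀ n (G : ℕ → ℕ → ℤ) z → Σ² n G * z ≡ Σ² n (λ l m → G l m * z)
Σ²-*ʳ n G z = trans (sum0to-*ʳ n (λ l → sum0to n (G l)) z) (sum0to-cong n (λ l → sum0to-*ʳ n (G l) z))

Σ²-shiftˡʳ : ∀ n (G : ℕ → ℕ → ℤ) → (∀ m → G 0 m ≡ 0ℤ) → (∀ l → G (suc l) 0 ≡ 0ℤ) →
             Σ² (suc n) G ≡ Σ² n (λ l m → G (suc l) (suc m))
Σ²-shiftˡʳ n G G0m≡0 Gl0≡0 =
  trans (sum0to-shift n (λ l → sum0to (suc n) (G l)) (sum0to-zero (suc n) G0m≡0))
        (sum0to-cong n (λ l → sum0to-shift n (G (suc l)) (Gl0≡0 l)))

Σ²-shiftˡ : ∀ n (G : ℕ → ℕ → ℤ) → (∀ m → G 0 m ≡ 0ℤ) → (∀ l → G (suc l) (suc n) ≡ 0ℤ) →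
            Σ² (suc n) G ≡ Σ² n (λ l m → G (suc l) m)
Σ²-shiftˡ n G G0m≡0 Gln≡0 =
  trans (sum0to-shift n (λ l → sum0to (suc n) (G l)) (sum0to-zero (suc n) G0m≡0))
        (sum0to-cong n (λ l → sum0to-drop-last n (G (suc l)) (Gln≡0 l)))

Σ²-shiftʳ : ∀ n (G : ℕ → ℕ → ℤ) → (∀ l → G l 0 ≡ 0ℤ) → (∀ m → G (suc n) (suc m) ≡ 0ℤ) →
            Σ² (suc n) G ≡ Σ² n (λ l m → G l (suc m))
Σ²-shiftʳ n G Gl0≡0 Gnm≡0 =
  trans (sum0to-cong (suc n) (λ l → sum0to-shift n (G l) (Gl0≡0 l)))
        (sum0to-drop-last n (λ l → sum0to n (G l ∘ suc)) (sum0to-zero n Gnm≡0))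

Σ²-drop-last : ∀ n (G : ℕ → ℕ → ℤ) → (∀ l → G l (suc n) ≡ 0ℤ) → (∀ m → G (suc n) m ≡ 0ℤ) →
               Σ² (suc n) G ≡ Σ² n G
Σ²-drop-last n G Gln≡0 Gnm≡0 =
  trans (sum0to-cong (suc n) (λ l → sum0to-drop-last n (G l) (Gln≡0 l)))
        (sum0to-drop-last n (λ l → sum0to n (G l)) (sum0to-zero n Gnm≡0))

Σ²≡sum1to² : ∀ n (G : ℕ → ℕ → ℤ) → (∀ m → G 0 m ≡ 0ℤ) → (∀ l → G l 0 ≡ 0ℤ) →
             Σ² n G ≡ sum1to n (λ l → sum1to n (G l))
Σ²≡sum1to² n G G0m≡0 Gl0≡0 =
  trans (cong₂ _+_ (sum0to-zero n G0m≡0)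
                   (sum1to-cong n (λ l _ _ → trans (cong (_+ sum1to n (G l)) (Gl0≡0 l)) (+-identityˡ _))))
        (+-identityˡ _)

infix 8 _↓_
_↓_ : ℤ → ℕ → ℤ
_↓_ = fallingFactorial

a<n⇒a↓n≡0 : ∀ {a n} → a < n → (+ a) ↓ n ≡ 0ℤ
a<n⇒a↓n≡0 {a} {suc n} (s≤s a≤n) with m≤n⇒m<n∨m≡n a≤n
... | inj₁ a<n  = cong (_* (+ a - + n)) (a<n⇒a↓n≡0 a<n)
... | inj₂ refl = trans (cong (_*_ ((+ a) ↓ a)) (+-inverseʳ (+ a))) (*-zeroʳ ((+ a) ↓ a))

n≤a⇒a↓n≢0 : ∀ {a n} → n ≤ a → (+ a) ↓ n ≢ 0ℤ
n≤a⇒a↓n≢0 {n = zero}  _   ()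
n≤a⇒a↓n≢0 {a} {suc n} n<a a↓1+n≡0 with i*j≡0⇒i≡0∨j≡0 ((+ a) ↓ n) a↓1+n≡0
... | inj₁ a↓n≡0 = n≤a⇒a↓n≢0 (≤-trans (n≤1+n n) n<a) a↓n≡0
... | inj₂ a-n≡0 = <-irrefl (sym (+-injective (i-j≡0⇒i≡j (+ a) (+ n) a-n≡0))) n<a

term : (ℕ → ℕ → ℕ) → ℤ → ℤ → ℕ → ℕ → ℤ
term F x y l m = + F l m * (x ↓ l * y ↓ m)

term≡0 : ∀ F x y l m → F l m ≡ 0 → term F x y l m ≡ 0ℤ
term≡0 F x y l m F≡0 = cong (λ c → + c * (x ↓ l * y ↓ m)) F≡0

term-⊕ : ∀ F G x y l m → term (F ⊕ G) x y l m ≡ term F x y l m + term G x y l m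
term-⊕ F G x y l m =
  trans (cong (_* (x ↓ l * y ↓ m)) (pos-+ (F l m) (G l m))) (*-distribʳ-+ (x ↓ l * y ↓ m) (+ F l m) (+ G l m))

+[lm∸k]*c : ∀ k l m c → (l N.* m < k → c ≡ 0) → + ((l N.* m N.∸ k) N.* c) ≡ (+ l * + m - + k) * + c
+[lm∸k]*c k l m c c≡0 with l N.* m N.<? k
... | yes lm<k = trans (cong +_ (n≡0⇒m*n≡0 (l N.* m N.∸ k) (c≡0 lm<k)))
                       (sym (trans (cong (λ c → (+ l * + m - + k) * + c) (c≡0 lm<k))
                                   (*-zeroʳ (+ l * + m - + k))))
... | no  lm≮k = trans (pos-* (l N.* m N.∸ k) c) (cong (_* + c) (sym +l*+m-+k))
  where
  +l*+m-+k : + l * + m - + k ≡ + (l N.* m N.∸ k)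
  +l*+m-+k = trans (cong (_- + k) (sym (pos-* l m))) (trans (m-n≡m⊖n (l N.* m) k) (⊖-≥ (≮⇒≥ lm≮k)))

-- With a = x↓l and b = y↓m, the factors a (x − L) and b (y − M) are x↓(l+1) and y↓(m+1) for L = l, M = m.
xy-K-split : ∀ (c a b x y L M K : ℤ) →
  c * (a * b) * (x * y - K) ≡
    c * ((a * (x - L)) * (b * (y - M))) + M * c * ((a * (x - L)) * b)
    + L * c * (a * (b * (y - M))) + (L * M - K) * c * (a * b)
xy-K-split = solve-∀

term-step : ∀ k x y l m →
  term (coeff k) x y l m * (x * y - + k) ≡
    term (shiftˡ (shiftʳ (coeff k))) x y (suc l) (suc m) + term (shiftˡ (scaleʳ (coeff k))) x y (suc l) m
    + term (shiftʳ (scaleˡ (coeff k))) x y l (suc m) + term (excess k (coeff k)) x y l m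
term-step k x y l m = begin
  + c * (x ↓ l * y ↓ m) * (x * y - + k)
    ≡⟨ xy-K-split (+ c) (x ↓ l) (y ↓ m) x y (+ l) (+ m) (+ k) ⟩
  + c * (x ↓ suc l * y ↓ suc m) + + m * + c * (x ↓ suc l * y ↓ m)
    + + l * + c * (x ↓ l * y ↓ suc m) + (+ l * + m - + k) * + c * (x ↓ l * y ↓ m)
    ≡⟨ cong₂ _+_ (cong₂ _+_ (cong (_+_ (+ c * (x ↓ suc l * y ↓ suc m)))
                                  (cong (_* (x ↓ suc l * y ↓ m)) (sym (pos-* m c))))
                            (cong (_* (x ↓ l * y ↓ suc m)) (sym (pos-* l c))))
                 (cong (_* (x ↓ l * y ↓ m)) (sym (+[lm∸k]*c k l m c (coeff-zero k l m)))) ⟩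
  + c * (x ↓ suc l * y ↓ suc m) + + (m N.* c) * (x ↓ suc l * y ↓ m)
    + + (l N.* c) * (x ↓ l * y ↓ suc m) + + ((l N.* m N.∸ k) N.* c) * (x ↓ l * y ↓ m) ∎
  where
  c : ℕ
  c = coeff k l m

expansion-step : ∀ k x y →
  Σ² k (term (coeff k) x y) * (x * y - + k) ≡ Σ² (suc k) (term (coeff (suc k)) x y)
expansion-step k x y = begin
  Σ² k (term (coeff k) x y) * (x * y - + k)
    ≡⟨ Σ²-*ʳ k (term (coeff k) x y) (x * y - + k) ⟩
  Σ² k (λ l m → term (coeff k) x y l m * (x * y - + k))
    ≡⟨ Σ²-cong k (term-step k x y) ⟩
  Σ² k (λ l m → A l m + B l m + C l m + term S x y l m)
    ≡⟨ Σ²-+₄ k A B C (term S x y) ⟩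
  Σ² k A + Σ² k B + Σ² k C + Σ² k (term S x y)
    ≡⟨ cong₂ _+_ (cong₂ _+_ (cong₂ _+_ reindexA reindexB) reindexC) reindexS ⟨
  Σ² (suc k) (term P x y) + Σ² (suc k) (term Q x y) + Σ² (suc k) (term R x y) + Σ² (suc k) (term S x y)
    ≡⟨ Σ²-+₄ (suc k) (term P x y) (term Q x y) (term R x y) (term S x y) ⟨
  Σ² (suc k) (λ l m → term P x y l m + term Q x y l m + term R x y l m + term S x y l m)
    ≡⟨ Σ²-cong (suc k) split ⟨
  Σ² (suc k) (term (coeff (suc k)) x y) ∎
  where
  P Q R S : ℕ → ℕ → ℕ
  P = shiftˡ (shiftʳ (coeff k))
  Q = shiftˡ (scaleʳ (coeff k))
  R = shiftʳ (scaleˡ (coeff k))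
  S = excess k (coeff k)

  A B C : ℕ → ℕ → ℤ
  A l m = term P x y (suc l) (suc m)
  B l m = term Q x y (suc l) m
  C l m = term R x y l (suc m)

  reindexA : Σ² (suc k) (term P x y) ≡ Σ² k A
  reindexA = Σ²-shiftˡʳ k (term P x y) (λ _ → refl) (λ _ → refl)

  reindexB : Σ² (suc k) (term Q x y) ≡ Σ² k B
  reindexB = Σ²-shiftˡ k (term Q x y) (λ _ → refl) λ l →
    term≡0 Q x y (suc l) (suc k) (n≡0⇒m*n≡0 (suc k) (coeff-vanishʳ k l (suc k) (n<1+n k)))

  reindexC : Σ² (suc k) (term R x y) ≡ Σ² k C
  reindexC = Σ²-shiftʳ k (term R x y) (λ _ → refl) λ m →
    term≡0 R x y (suc k) (suc m) (n≡0⇒m*n≡0 (suc k) (coeff-vanishˡ k (suc k) m (n<1+n k)))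

  reindexS : Σ² (suc k) (term S x y) ≡ Σ² k (term S x y)
  reindexS = Σ²-drop-last k (term S x y)
    (λ l → term≡0 S x y l (suc k) (n≡0⇒m*n≡0 (l N.* suc k N.∸ k) (coeff-vanishʳ k l (suc k) (n<1+n k))))
    (λ m → term≡0 S x y (suc k) m (n≡0⇒m*n≡0 (suc k N.* m N.∸ k) (coeff-vanishˡ k (suc k) m (n<1+n k))))

  split : ∀ l m → term (coeff (suc k)) x y l m ≡
                  term P x y l m + term Q x y l m + term R x y l m + term S x y l m
  split l m =
    trans (term-⊕ (P ⊕ Q ⊕ R) S x y l m)
          (cong (_+ term S x y l m) (trans (term-⊕ (P ⊕ Q) R x y l m)
                                           (cong (_+ term R x y l m) (term-⊕ P Q x y l m))))

↓-product-expansion : ∀ k x y → (x * y) ↓ k ≡ Σ² k (term (coeff k) x y)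
↓-product-expansion zero    x y = refl
↓-product-expansion (suc k) x y =
  trans (cong (_* (x * y - + k)) (↓-product-expansion k x y)) (expansion-step k x y)

coeff-isExpansion : ∀ k → 1 ≤ k → IsExpansion k (λ l m → + coeff k l m)
coeff-isExpansion k 1≤k x y =
  trans (↓-product-expansion k x y)
        (Σ²≡sum1to² k (term (coeff k) x y)
          (λ m → term≡0 (coeff k) x y 0 m (coeff-zero k 0 m 1≤k))
          (λ l → term≡0 (coeff k) x y l 0 (coeff-zero k l 0 (subst (_< k) (sym (ℕₚ.*-zeroʳ l)) 1≤k))))

↓-coefficients-unique : ∀ k (d e : ℕ → ℤ) →
  (∀ x → sum1to k (λ l → d l * x ↓ l) ≡ sum1to k (λ l → e l * x ↓ l)) →
  ∀ l → 1 ≤ l → l ≤ k → d l ≡ e l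
↓-coefficients-unique k d e d≈e l 1≤l l≤k = agree-upto l l≤k l 1≤l ≤-refl
  where
  agree-upto : ∀ j → j ≤ k → ∀ i → 1 ≤ i → i ≤ j → d i ≡ e i
  agree-upto zero    _     i (s≤s _) ()
  agree-upto (suc j) 1+j≤k i 1≤i i≤1+j with m≤n⇒m<n∨m≡n i≤1+j
  ... | inj₁ (s≤s i≤j) = agree-upto j (≤-trans (n≤1+n j) 1+j≤k) i 1≤i i≤j
  ... | inj₂ refl      =
    *-cancelʳ-≡ (d (suc j)) (e (suc j)) (x ↓ suc j) {{≢-nonZero (n≤a⇒a↓n≢0 {suc j} ≤-refl)}}
      (∙-cancelˡ (sum1to j (λ l → e l * x ↓ l)) _ _
        (trans (cong (_+ d (suc j) * x ↓ suc j) (sym prefix)) evaluated))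
    where
    x : ℤ
    x = + suc j
    truncate : ∀ f → sum1to k (λ l → f l * x ↓ l) ≡ sum1to (suc j) (λ l → f l * x ↓ l)
    truncate f = sum1to-truncate k (λ l → f l * x ↓ l) 1+j≤k
      (λ l 1+j<l _ → trans (cong (_*_ (f l)) (a<n⇒a↓n≡0 1+j<l)) (*-zeroʳ (f l)))
    evaluated : sum1to (suc j) (λ l → d l * x ↓ l) ≡ sum1to (suc j) (λ l → e l * x ↓ l)
    evaluated = trans (sym (truncate d)) (trans (d≈e x) (truncate e))
    prefix : sum1to j (λ l → d l * x ↓ l) ≡ sum1to j (λ l → e l * x ↓ l)
    prefix = sum1to-cong j λ l 1≤l l≤j →
      cong (_* x ↓ l) (agree-upto j (≤-trans (n≤1+n j) 1+j≤k) l 1≤l l≤j)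

IsExpansion-unique : ∀ k (c c′ : ℕ → ℕ → ℤ) → IsExpansion k c → IsExpansion k c′ →
  ∀ l m → 1 ≤ l → l ≤ k → 1 ≤ m → m ≤ k → c l m ≡ c′ l m
IsExpansion-unique k c c′ expand expand′ l m 1≤l l≤k 1≤m m≤k =
  ↓-coefficients-unique k (c l) (c′ l) rows-agree m 1≤m m≤k
  where
  row : (ℕ → ℕ → ℤ) → ℤ → ℕ → ℤ
  row c y l = sum1to k (λ m → c l m * y ↓ m)
  regroup : ∀ c x y → sum1to k (λ l → sum1to k (λ m → c l m * (x ↓ l * y ↓ m))) ≡
                      sum1to k (λ l → row c y l * x ↓ l)
  regroup c x y = sum1to-cong k λ l _ _ →
    trans (sum1to-cong k (λ m _ _ → trans (cong (_*_ (c l m)) (*-comm (x ↓ l) (y ↓ m)))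
                                          (sym (*-assoc (c l m) (y ↓ m) (x ↓ l)))))
          (sym (sum1to-*ʳ k (λ m → c l m * y ↓ m) (x ↓ l)))
  rows-agree : ∀ y → row c y l ≡ row c′ y l
  rows-agree y = ↓-coefficients-unique k (row c y) (row c′ y)
    (λ x → trans (sym (regroup c x y)) (trans (sym (expand x y)) (trans (expand′ x y) (regroup c′ x y))))
    l 1≤l l≤k

corollary1 : (k : ℕ) → 1 ≤ k →
    Σ (ℕ → ℕ → ℤ) (λ c → IsExpansion k c)
    × (∀ (c : ℕ → ℕ → ℤ) → IsExpansion k c →
        ∀ (l m : ℕ) → 1 ≤ l → l ≤ k → 1 ≤ m → m ≤ k →
          (l N.* m < k → c l m ≡ + 0)
          × (l N.* m ≥ k → + 0 Z.< c l m))
corollary1 k 1≤k = (ĉ , coeff-isExpansion k 1≤k) , λ c expand l m 1≤l l≤k 1≤m m≤k →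
  let c≡ĉ = IsExpansion-unique k c ĉ expand (coeff-isExpansion k 1≤k) l m 1≤l l≤k 1≤m m≤k in
  (λ lm<k → trans c≡ĉ (cong +_ (coeff-zero k l m lm<k))) ,
  (λ k≤lm → subst (+ 0 Z.<_) (sym c≡ĉ) (+<+ (coeff-positive k 1≤l l≤k 1≤m m≤k k≤lm)))
  where
  ĉ : ℕ → ℕ → ℤ
  ĉ l m = + coeff k l m
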